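{- Let $A$ be a residuated lattice and $(L,\lambda)$ its reticulation. Then for any subset $X$ of $A$, $\lambda(X^{\top})=\lambda(X)^{\top}$.
   Context: A residuated lattice is an algebra $(A,\vee,\wedge,\odot,\rightarrow,0,1)$ with $(A,\vee,\wedge,0,1)$ a bounded lattice, $(A,\odot,1)$ a commutative monoid and $a\le b\rightarrow c$ iff $a\odot b\le c$. Write $a^n$ for the $n$-fold $\odot$-power. A reticulation of $A$ is a pair $(L,\lambda)$ with $L$ a bounded distributive lattice and $\lambda:A\to L$ such that for all $a,b$: (1) $\lambda(a\odot b)=\lambda(a)\wedge\lambda(b)$; (2) $\lambda(a\vee b)=\lambda(a)\vee\lambda(b)$; (3) $\lambda(0)=0,\lambda(1)=1$; (4) $\lambda$ surjective; (5) $\lambda(a)\le\lambda(b)$ iff $a^n\le b$ for some $n\ge1$. For a bounded lattice or residuated lattice $M$ and $X\subseteq M$, the co-annihilator of $X$ is $X^{\top}=\{m\in M\mid m\vee x=1 \text{ for all } x\in X\}$. -}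

module Defs where

open import Level using (Level; _⊔_; suc)
open import Data.Nat using (ℕ; zero) renaming (suc to sucℕ)
open import Data.Product using (Σ; ∃; _×_; _,_)
open import Relation.Binary.PropositionalEquality using (_≡_)
open import Function.Bundles using (_⇔_)

record ResiduatedLattice (a : Level) : Set (suc a) where
  infixr 6 _∨_
  infixr 7 _∧_
  infixr 8 _⊙_
  infixr 5 _⇒_
  field
    Carrier : Set a
    _∨_ _∧_ _⊙_ _⇒_ : Carrier → Carrier → Carrier
    𝟘 𝟙 : Carrier
    ∨-comm : ∀ x y → x ∨ y ≡ y ∨ x
    ∧-comm : ∀ x y → x ∧ y ≡ y ∧ x
    ∨-assoc : ∀ x y z → (x ∨ y) ∨ z ≡ x ∨ (y ∨ z)
    ∧-assoc : ∀ x y z → (x ∧ y) ∧ z ≡ x ∧ (y ∧ z)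
    ∨-absorbs-∧ : ∀ x y → x ∨ (x ∧ y) ≡ x
    ∧-absorbs-∨ : ∀ x y → x ∧ (x ∨ y) ≡ x
    𝟘-least : ∀ x → 𝟘 ∧ x ≡ 𝟘
    𝟙-greatest : ∀ x → x ∧ 𝟙 ≡ x
    ⊙-comm : ∀ x y → x ⊙ y ≡ y ⊙ x
    ⊙-assoc : ∀ x y z → (x ⊙ y) ⊙ z ≡ x ⊙ (y ⊙ z)
    ⊙-identityʳ : ∀ x → x ⊙ 𝟙 ≡ x
    residuation : ∀ x y z → (x ∧ (y ⇒ z) ≡ x) ⇔ ((x ⊙ y) ∧ z ≡ x ⊙ y)

  _≤_ : Carrier → Carrier → Set a
  x ≤ y = x ∧ y ≡ x

  -- n-fold ⊙-power: pow n x = x^(n+1)  (so n ranges over exponents ≥ 1)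
  pow : ℕ → Carrier → Carrier
  pow zero x = x
  pow (sucℕ n) x = x ⊙ pow n x

record BoundedDistributiveLattice (ℓ : Level) : Set (suc ℓ) where
  infixr 6 _∨_
  infixr 7 _∧_
  field
    Carrier : Set ℓ
    _∨_ _∧_ : Carrier → Carrier → Carrier
    𝟘 𝟙 : Carrier
    ∨-comm : ∀ x y → x ∨ y ≡ y ∨ x
    ∧-comm : ∀ x y → x ∧ y ≡ y ∧ x
    ∨-assoc : ∀ x y z → (x ∨ y) ∨ z ≡ x ∨ (y ∨ z)
    ∧-assoc : ∀ x y z → (x ∧ y) ∧ z ≡ x ∧ (y ∧ z)
    ∨-absorbs-∧ : ∀ x y → x ∨ (x ∧ y) ≡ x
    ∧-absorbs-∨ : ∀ x y → x ∧ (x ∨ y) ≡ x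
    ∧-distribˡ-∨ : ∀ x y z → x ∧ (y ∨ z) ≡ (x ∧ y) ∨ (x ∧ z)
    𝟘-least : ∀ x → 𝟘 ∧ x ≡ 𝟘
    𝟙-greatest : ∀ x → x ∧ 𝟙 ≡ x

  _≤_ : Carrier → Carrier → Set ℓ
  x ≤ y = x ∧ y ≡ x

record Reticulation {a} (A : ResiduatedLattice a) (ℓ : Level)
       : Set (a ⊔ suc ℓ) where
  private module A = ResiduatedLattice A
  field
    L : BoundedDistributiveLattice ℓ
  private module L = BoundedDistributiveLattice L
  field
    lam : A.Carrier → L.Carrier
    lam-⊙ : ∀ x y → lam (x A.⊙ y) ≡ lam x L.∧ lam y
    lam-∨ : ∀ x y → lam (x A.∨ y) ≡ lam x L.∨ lam y
    lam-𝟘 : lam A.𝟘 ≡ L.𝟘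
    lam-𝟙 : lam A.𝟙 ≡ L.𝟙
    lam-surj : ∀ y → ∃ λ x → lam x ≡ y
    -- λ(a) ≤ λ(b) iff a^n ≤ b for some n ≥ 1 (a^(k+1) = pow k a)
    lam-≤ : ∀ x y → (lam x L.≤ lam y) ⇔ (∃ λ k → A.pow k x A.≤ y)

Subset : ∀ {c} → Set c → (p : Level) → Set (c ⊔ suc p)
Subset C p = C → Set p

coannRL : ∀ {a p} (A : ResiduatedLattice a) →
          Subset (ResiduatedLattice.Carrier A) p →
          Subset (ResiduatedLattice.Carrier A) (a ⊔ p)
coannRL A X m = ∀ x → X x → m ∨ x ≡ 𝟙
  where open ResiduatedLattice A

coannL : ∀ {ℓ p} (L : BoundedDistributiveLattice ℓ) →
         Subset (BoundedDistributiveLattice.Carrier L) p →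
         Subset (BoundedDistributiveLattice.Carrier L) (ℓ ⊔ p)
coannL L X m = ∀ x → X x → m ∨ x ≡ 𝟙
  where open BoundedDistributiveLattice L

image : ∀ {c d p} {C : Set c} {D : Set d} → (C → D) →
        Subset C p → Subset D (c ⊔ d ⊔ p)
image f X y = ∃ λ x → X x × f x ≡ y

_≐_ : ∀ {c p q} {C : Set c} → Subset C p → Subset C q → Set (c ⊔ p ⊔ q)
X ≐ Y = (∀ z → X z → Y z) × (∀ z → Y z → X z)

-- Since λ(a ∨ b) = λ(a) ∨ λ(b) and λ(1) = 1, the whole theorem reduces to λ reflecting the top:
-- if λ(a) = 1 then λ(1) ≤ λ(a), so 1 = 1ⁿ ≤ a for some n. Surjectivity of λ then lets every
-- element of λ(X)^⊤ be written as λ(m), and m ∨ x = 1 for x ∈ X follows from λ(m ∨ x) = 1.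
module Submission where

open import Defs
open import Data.Nat using (zero; suc)
open import Data.Product using (_,_)
open import Relation.Binary.PropositionalEquality
open import Function.Bundles using (Equivalence)

module _ {ℓ} (L : BoundedDistributiveLattice ℓ) where
  open BoundedDistributiveLattice L

  ∧-idem : ∀ x → x ∧ x ≡ x
  ∧-idem x = begin
    x ∧ x            ≡⟨ cong (x ∧_) (sym (∨-absorbs-∧ x x)) ⟩
    x ∧ (x ∨ x ∧ x)  ≡⟨ ∧-absorbs-∨ x (x ∧ x) ⟩
    x                ∎
    where open ≡-Reasoning

module _ {a} (A : ResiduatedLattice a) where
  open ResiduatedLattice A

  pow-𝟙 : ∀ k → pow k 𝟙 ≡ 𝟙
  pow-𝟙 zero    = refl
  pow-𝟙 (suc k) = trans (cong (𝟙 ⊙_) (pow-𝟙 k)) (⊙-identityʳ 𝟙)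

  𝟙≤⇒≡𝟙 : ∀ {x} → 𝟙 ≤ x → x ≡ 𝟙
  𝟙≤⇒≡𝟙 {x} 𝟙≤x = begin
    x      ≡⟨ sym (𝟙-greatest x) ⟩
    x ∧ 𝟙  ≡⟨ ∧-comm x 𝟙 ⟩
    𝟙 ∧ x  ≡⟨ 𝟙≤x ⟩
    𝟙      ∎
    where open ≡-Reasoning

module _ {a ℓ} {A : ResiduatedLattice a} (R : Reticulation A ℓ) where
  private module A = ResiduatedLattice A
  open Reticulation R
  private module L = BoundedDistributiveLattice L

  lam≡𝟙⇒≡𝟙 : ∀ {x} → lam x ≡ L.𝟙 → x ≡ A.𝟙
  lam≡𝟙⇒≡𝟙 {x} lamx≡𝟙 with Equivalence.to (lam-≤ A.𝟙 x) lam𝟙≤lamx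
    where
    lam𝟙≤lamx : lam A.𝟙 L.∧ lam x ≡ lam A.𝟙
    lam𝟙≤lamx = trans (cong (lam A.𝟙 L.∧_) (trans lamx≡𝟙 (sym lam-𝟙))) (∧-idem L (lam A.𝟙))
  ... | k , 𝟙ᵏ≤x = 𝟙≤⇒≡𝟙 A (subst (λ t → t A.≤ x) (pow-𝟙 A k) 𝟙ᵏ≤x)

  module _ {p} (X : Subset A.Carrier p) where

    image-coann⊆coann-image : ∀ z → image lam (coannRL A X) z → coannL L (image lam X) z
    image-coann⊆coann-image _ (m , m∈X⊤ , refl) _ (x , x∈X , refl) =
      trans (sym (lam-∨ m x)) (trans (cong lam (m∈X⊤ x x∈X)) lam-𝟙)

    coann-image⊆image-coann : ∀ z → coannL L (image lam X) z → image lam (coannRL A X) z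
    coann-image⊆image-coann z z∈λX⊤ with lam-surj z
    ... | m , refl = m , m∈X⊤ , refl
      where
      m∈X⊤ : coannRL A X m
      m∈X⊤ x x∈X = lam≡𝟙⇒≡𝟙 (trans (lam-∨ m x) (z∈λX⊤ (lam x) (x , x∈X , refl)))

mainTheorem9 : ∀ {a ℓ p} (A : ResiduatedLattice a) (R : Reticulation A ℓ)
    (X : Subset (ResiduatedLattice.Carrier A) p) →
    image (Reticulation.lam R) (coannRL A X)
      ≐ coannL (Reticulation.L R) (image (Reticulation.lam R) X)
mainTheorem9 A R X = image-coann⊆coann-image R X , coann-image⊆image-coann R X
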